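{- (1) Let $A$ be a $d$-dimensional $(0,1)$-array of order $n$. If $\mathrm{Per}_k A>0$ for some positive integer $k$, then $\mathrm{Per}_{km}A>0$ for every integer $m\ge 1$. (2) Let $G$ be a binary quasigroup of order $n$. If $\mathrm{Per}_k M(G^{[d]})>0$ for some $k$ and $d$, then $\mathrm{Per}_k M(G^{[d+2m]})>0$ for every integer $m\ge0$. Moreover, $\mathrm{per}_k M(G^{[d+2m]})\ge\left(\frac{(kn)!}{k!^n}\right)^m\mathrm{per}_k M(G^{[d]})$ for every integer $m\ge 0$.
   Context: A binary quasigroup of order $n$ is a binary operation $*$ on $\{1,\ldots,n\}$ such that for all $a,b$ each of $a*x=b$ and $x*a=b$ has a unique solution $x$. For $d\ge1$, $M(G^{[d]})$ is the $(d+1)$-dimensional $(0,1)$-array of order $n$ with indices $(x_0,\ldots,x_d)\in\{1,\ldots,n\}^{d+1}$ whose entry is $1$ iff $(\cdots((x_0*x_1)*x_2)*\cdots)*x_d=1$. For a $D$-dimensional array $A=(a_\alpha)$ of order $n$, a hyperplane is the set of indices with one coordinate fixed; a $k$-multiplex is a multiset $K$ of $kn$ indices such that every hyperplane contains exactly $k$ elements of $K$ counted with multiplicity; a $k$-plex is a $k$-multiplex without repeated elements. $\mathrm{Per}_k A=\sum_K\prod_{\alpha\in K}a_\alpha$ over all $k$-multiplexes $K$ (product with multiplicity), and $\mathrm{per}_k A=\sum_K\prod_{\alpha\in K}a_\alpha$ over all $k$-plexes $K$. For a $(0,1)$-array these count the $k$-multiplexes, resp. $k$-plexes, contained in the support.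 -}

module Defs where

open import Data.Nat using (ℕ; zero; suc; _+_; _*_; _^_; _≡ᵇ_)
open import Data.Bool using (Bool; true; false; _∧_; if_then_else_)
import Relation.Nullary.Decidable
open import Data.Fin as Fin using (Fin)
open import Data.Vec using (Vec; []; _∷_; lookup; foldl)
open import Data.List using (List; []; _∷_; map; concatMap; allFin; upTo; filter; zip)
open import Data.Bool.ListAction using (and)
open import Data.Nat.ListAction using (sum; product)
open import Data.Product using (_×_; _,_; proj₁; proj₂; ∃!)
open import Data.Sum using (_⊎_)
open import Relation.Binary.PropositionalEquality using (_≡_)

Index : ℕ → ℕ → Set
Index D n = Vec (Fin n) D

Array : ℕ → ℕ → Set
Array D n = Index D n → ℕ

Is01 : ∀ {D n} → Array D n → Set
Is01 A = ∀ α → A α ≡ 0 ⊎ A α ≡ 1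

indices : (D n : ℕ) → List (Index D n)
indices zero    n = [] ∷ []
indices (suc D) n = concatMap (λ i → map (i ∷_) (indices D n)) (allFin n)

bounded : ℕ → ℕ → List (List ℕ)
bounded b zero    = [] ∷ []
bounded b (suc N) = concatMap (λ m → map (m ∷_) (bounded b N)) (upTo (suc b))

-- A multiset of indices is given by a multiplicity list aligned with `indices D n`.
-- Number of elements (with multiplicity) of the multiset in the hyperplane x_i = v.
hyperCount : ∀ {D n} → Fin D → Fin n → List (Index D n × ℕ) → ℕ
hyperCount i v ps = sum (map proj₂ (filter (λ p → lookup (proj₁ p) i Fin.≟ v) ps))

isMultiplex : (D n k : ℕ) → List ℕ → Bool
isMultiplex D n k μ =
  (sum μ ≡ᵇ k * n) ∧
  and (concatMap (λ i → map (λ v → hyperCount i v (zip (indices D n) μ) ≡ᵇ k) (allFin n)) (allFin D))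

weight : ∀ {D n} → Array D n → List ℕ → ℕ
weight {D} {n} A μ = product (map (λ p → A (proj₁ p) ^ proj₂ p) (zip (indices D n) μ))

PerB : ∀ {D n} → ℕ → ℕ → Array D n → ℕ
PerB {D} {n} b k A =
  sum (map (weight A) (filter (λ μ → isMultiplex D n k μ Data.Bool.≟ true)
                              (bounded b (Data.List.length (indices D n)))))

-- Per_k: over all k-multiplexes (multiplicities are automatically ≤ kn)
Per : ∀ {D n} → ℕ → Array D n → ℕ
Per {D} {n} k A = PerB (k * n) k A

-- per_k: over all k-plexes (multiplicities ≤ 1)
per : ∀ {D n} → ℕ → Array D n → ℕ
per k A = PerB 1 k A

IsQuasigroup : ∀ {n} → (Fin n → Fin n → Fin n) → Set
IsQuasigroup {n} _*_ =
  ∀ a b → ∃! _≡_ (λ x → a * x ≡ b) × ∃! _≡_ (λ x → x * a ≡ b)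

-- M(G^[d]) for a quasigroup of order suc n (element "1" is Fin.zero):
-- entry at (x₀,…,x_d) is 1 iff (⋯((x₀*x₁)*x₂)*⋯)*x_d = 1
M : ∀ {n} → (Fin (suc n) → Fin (suc n) → Fin (suc n)) → (d : ℕ) → Array (suc d) (suc n)
M _*_ d (x₀ ∷ xs) =
  if Relation.Nullary.Decidable.isYes (foldl (λ _ → Fin (suc _)) _*_ x₀ xs Fin.≟ Fin.zero) then 1 else 0

-- (1) Repeating every index of a k-multiplex m times gives a km-multiplex with the same support.
--
-- (2) Writing 1 for the distinguished element, the map (x₀, x₁, …, x_d) ↦ (y, y⧹1, 1⧹x₀, x₁, …, x_d)
-- sends the support of M(G^[d]) into that of M(G^[d+2]) for every y, since y(y⧹1) = 1 and
-- 1(1⧹x₀) = x₀. Pair the kn indices of a k-multiplex with the letters of a word containing every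
-- element of G exactly k times, and apply the map with y the paired letter: the result is a
-- k-multiplex of M(G^[d+2]), because each hyperplane of the new array is the preimage of a hyperplane
-- of the old one or of a letter of the word. For k-plexes the pair (plex, word) can be read back from
-- the image, and there are (kn)!/k!ⁿ such words; iterating this step m times gives the bound.

module Submission where

open import Defs
open import Data.Nat using (ℕ; suc; _*_; _^_; _+_; _≤_; _>_; _≥_; _!)
open import Data.Fin using (Fin)
open import Data.Product using (_×_)

open import Level using (Level)
import Data.Fin as Fin
open import Data.Vec as Vec using (lookup)
open import Data.Vec.Properties using (≡-dec) renaming (∷-injective to ∷-injectiveᵛ)
open import Function using (_∘_; _⇔_; mk⇔; Equivalence)
open import Data.Nat using (zero; _∸_; _⊓_; z≤n; s≤s; >-nonZero)
open import Data.Nat.Properties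
open import Data.Fin.Properties using (all?)
open import Data.Nat.ListAction using (sum; product)
open import Data.Nat.ListAction.Properties using (sum-++; product-++)
open import Data.Bool as Bool using (Bool; true; false; T)
open import Data.Bool.Properties using (T-≡; T-∧)
open import Data.Bool.ListAction using (and)
open import Data.List
  using (List; []; _∷_; [_]; _++_; map; concat; concatMap; zip; zipWith; filter; replicate; length; allFin; upTo;
         cartesianProductWith)
open import Data.List.Properties
  using (map-++; map-cong; map-cong-local; map-∘; length-map; length-++; length-tabulate; length-zipWith; ∷-injective)
open import Data.List.Membership.Propositional using (_∈_; _∉_)
open import Data.List.Membership.Propositional.Properties
  using (∈-map⁻; ∈-∃++; ∈-++⁻; ∈-++⁺ˡ; ∈-++⁺ʳ; ∈-allFin; ∈-upTo⁺; ∈-upTo⁻; ∈-filter⁺; ∈-filter⁻;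
         ∈-cartesianProductWith⁺; ∈-cartesianProductWith⁻)
open import Data.List.Relation.Unary.All as All using (All; []; _∷_)
open import Data.List.Relation.Unary.All.Properties as All using ()
open import Data.List.Relation.Unary.Any using (here; there)
open import Data.List.Relation.Unary.Unique.Propositional using (Unique)
import Data.List.Relation.Unary.Unique.Propositional.Properties as Unique
open import Data.List.Relation.Unary.AllPairs using ([]; _∷_)
open import Data.Product using (∃-syntax; _,_; proj₁; proj₂)
open import Data.Sum using (inj₁; inj₂)
open import Data.Empty using (⊥-elim)
open import Relation.Nullary using (¬_; Dec; yes; no; does; _because_; ofʸ; ofⁿ)
open import Relation.Nullary.Decidable using (dec-true; dec-false)
open import Relation.Unary using (Pred; Decidable)
open import Relation.Binary using (DecidableEquality)
open import Relation.Binary.PropositionalEquality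
  using (_≡_; _≢_; refl; sym; trans; cong; cong₂; subst; module ≡-Reasoning)
import Algebra.Properties.CommutativeSemigroup as CommutativeSemigroupProperties
module +-Semigroup = CommutativeSemigroupProperties +-commutativeSemigroup
module *-Semigroup = CommutativeSemigroupProperties *-commutativeSemigroup

private variable
  a b c ℓ : Level
  A : Set a
  B : Set b
  C : Set c

-- Sums and counts along lists

toℕ : Bool → ℕ
toℕ true = 1
toℕ false = 0

countᵇ : (A → Bool) → List A → ℕ
countᵇ p xs = sum (map (toℕ ∘ p) xs)

sum-map-+ : (f g : A → ℕ) (xs : List A) →
  sum (map (λ x → f x + g x) xs) ≡ sum (map f xs) + sum (map g xs)
sum-map-+ f g [] = refl
sum-map-+ f g (x ∷ xs) =
  trans (cong (f x + g x +_) (sum-map-+ f g xs)) (+-Semigroup.interchange (f x) (g x) _ _)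

product-map-* : (f g : A → ℕ) (xs : List A) →
  product (map (λ x → f x * g x) xs) ≡ product (map f xs) * product (map g xs)
product-map-* f g [] = refl
product-map-* f g (x ∷ xs) =
  trans (cong (f x * g x *_) (product-map-* f g xs)) (*-Semigroup.interchange (f x) (g x) _ _)

sum-map-*ˡ : (k : ℕ) (f : A → ℕ) (xs : List A) → sum (map (λ x → k * f x) xs) ≡ k * sum (map f xs)
sum-map-*ˡ k f [] = sym (*-zeroʳ k)
sum-map-*ˡ k f (x ∷ xs) = trans (cong (k * f x +_) (sum-map-*ˡ k f xs)) (sym (*-distribˡ-+ k (f x) _))

sum-map-*ʳ : (f : A → ℕ) (k : ℕ) (xs : List A) → sum (map (λ x → f x * k) xs) ≡ sum (map f xs) * k
sum-map-*ʳ f k [] = refl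
sum-map-*ʳ f k (x ∷ xs) = trans (cong (f x * k +_) (sum-map-*ʳ f k xs)) (sym (*-distribʳ-+ k (f x) _))

sum-map-const : (k : ℕ) (xs : List A) → sum (map (λ _ → k) xs) ≡ length xs * k
sum-map-const k [] = refl
sum-map-const k (x ∷ xs) = cong (k +_) (sum-map-const k xs)

product-map-const : (k : ℕ) (xs : List A) → product (map (λ _ → k) xs) ≡ k ^ length xs
product-map-const k [] = refl
product-map-const k (x ∷ xs) = cong (k *_) (product-map-const k xs)

sum-map-cong : {f g : A → ℕ} (xs : List A) → (∀ {x} → x ∈ xs → f x ≡ g x) →
  sum (map f xs) ≡ sum (map g xs)
sum-map-cong xs f≡g = cong sum (map-cong-local (All.tabulate f≡g))

product-map-cong : {f g : A → ℕ} (xs : List A) → (∀ {x} → x ∈ xs → f x ≡ g x) →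
  product (map f xs) ≡ product (map g xs)
product-map-cong xs f≡g = cong product (map-cong-local (All.tabulate f≡g))

sum-map-++ : (f : A → ℕ) (xs ys : List A) → sum (map f (xs ++ ys)) ≡ sum (map f xs) + sum (map f ys)
sum-map-++ f xs ys = trans (cong sum (map-++ f xs ys)) (sum-++ (map f xs) (map f ys))

sum-map-cartesianProductWith : (w : C → ℕ) (f : A → B → C) (xs : List A) (ys : List B) →
  sum (map w (cartesianProductWith f xs ys)) ≡ sum (map (λ x → sum (map (w ∘ f x) ys)) xs)
sum-map-cartesianProductWith w f [] ys = refl
sum-map-cartesianProductWith w f (x ∷ xs) ys = begin
  sum (map w (map (f x) ys ++ cartesianProductWith f xs ys))
    ≡⟨ sum-map-++ w (map (f x) ys) _ ⟩
  sum (map w (map (f x) ys)) + sum (map w (cartesianProductWith f xs ys))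
    ≡⟨ cong₂ _+_ (cong sum (sym (map-∘ ys))) (sum-map-cartesianProductWith w f xs ys) ⟩
  sum (map (w ∘ f x) ys) + sum (map (λ x → sum (map (w ∘ f x) ys)) xs) ∎
  where open ≡-Reasoning

∈⇒≤sum-map : (w : A → ℕ) {x : A} {xs : List A} → x ∈ xs → w x ≤ sum (map w xs)
∈⇒≤sum-map w (here refl) = m≤m+n _ _
∈⇒≤sum-map w {xs = y ∷ _} (there x∈xs) = ≤-trans (∈⇒≤sum-map w x∈xs) (m≤n+m _ (w y))

sum-map>0⇒∃ : (w : A → ℕ) (xs : List A) → sum (map w xs) > 0 → ∃[ x ] x ∈ xs × w x > 0
sum-map>0⇒∃ w (x ∷ xs) pos with w x in eq
... | suc _ = x , here refl , subst (_> 0) (sym eq) (s≤s z≤n)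
... | zero with sum-map>0⇒∃ w xs pos
...   | y , y∈xs , wy>0 = y , there y∈xs , wy>0

sum-map-mono-⊆ : (w : A → ℕ) {xs ys : List A} → Unique ys → (∀ {y} → y ∈ ys → y ∈ xs) →
  sum (map w ys) ≤ sum (map w xs)
sum-map-mono-⊆ w {ys = []} [] ys⊆xs = z≤n
sum-map-mono-⊆ w {ys = y ∷ ys} (y∉ys ∷ ys!) ys⊆xs with ∈-∃++ (ys⊆xs (here refl))
... | us , vs , refl = begin
  w y + sum (map w ys)            ≤⟨ +-monoʳ-≤ (w y) (sum-map-mono-⊆ w ys! ys⊆us++vs) ⟩
  w y + sum (map w (us ++ vs))    ≡⟨ cong (w y +_) (sum-map-++ w us vs) ⟩
  w y + (sum (map w us) + sum (map w vs))  ≡⟨ +-Semigroup.x∙yz≈y∙xz (w y) (sum (map w us)) _ ⟩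
  sum (map w us) + (w y + sum (map w vs))  ≡⟨ sum-map-++ w us (y ∷ vs) ⟨
  sum (map w (us ++ y ∷ vs))      ∎
  where
  open ≤-Reasoning
  ys⊆us++vs : ∀ {z} → z ∈ ys → z ∈ us ++ vs
  ys⊆us++vs z∈ys with ∈-++⁻ us (ys⊆xs (there z∈ys))
  ... | inj₁ z∈us = ∈-++⁺ˡ z∈us
  ... | inj₂ (here refl) = ⊥-elim (All.lookup y∉ys z∈ys refl)
  ... | inj₂ (there z∈vs) = ∈-++⁺ʳ us z∈vs

sum-map-proj₂-filter : {P : Pred A ℓ} (P? : Decidable P) (ps : List (A × ℕ)) →
  sum (map proj₂ (filter (P? ∘ proj₁) ps)) ≡ sum (map (λ (x , m) → toℕ (does (P? x)) * m) ps)
sum-map-proj₂-filter P? [] = refl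
sum-map-proj₂-filter P? ((x , m) ∷ ps) with does (P? x)
... | true = cong₂ _+_ (sym (+-identityʳ m)) (sum-map-proj₂-filter P? ps)
... | false = sum-map-proj₂-filter P? ps

zip-map-self : (f : A → B) (xs : List A) → zip xs (map f xs) ≡ map (λ x → x , f x) xs
zip-map-self f [] = refl
zip-map-self f (x ∷ xs) = cong ((x , f x) ∷_) (zip-map-self f xs)

map-≡⇒≡ : {f g : A → B} {xs : List A} → map f xs ≡ map g xs → ∀ {x} → x ∈ xs → f x ≡ g x
map-≡⇒≡ {xs = _ ∷ _} eq (here refl) = proj₁ (∷-injective eq)
map-≡⇒≡ {xs = _ ∷ _} eq (there x∈xs) = map-≡⇒≡ (proj₂ (∷-injective eq)) x∈xs

length-filter : {P : Pred A ℓ} (P? : Decidable P) (xs : List A) → length (filter P? xs) ≡ countᵇ (does ∘ P?) xs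
length-filter P? [] = refl
length-filter P? (x ∷ xs) with does (P? x)
... | true = cong suc (length-filter P? xs)
... | false = length-filter P? xs

repeat : ℕ → List A → List A
repeat m xs = concat (replicate m xs)

countᵇ-repeat : (p : A → Bool) (m : ℕ) (xs : List A) → countᵇ p (repeat m xs) ≡ countᵇ p xs * m
countᵇ-repeat p zero xs = sym (*-zeroʳ (countᵇ p xs))
countᵇ-repeat p (suc m) xs =
  trans (sum-map-++ (toℕ ∘ p) xs (repeat m xs))
        (trans (cong (countᵇ p xs +_) (countᵇ-repeat p m xs)) (sym (*-suc (countᵇ p xs) m)))

length-repeat : (m : ℕ) (xs : List A) → length (repeat m xs) ≡ length xs * m
length-repeat zero xs = sym (*-zeroʳ (length xs))
length-repeat (suc m) xs =
  trans (length-++ xs) (trans (cong (length xs +_) (length-repeat m xs)) (sym (*-suc (length xs) m)))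

product-map-repeat : (f : A → ℕ) (m : ℕ) (xs : List A) → product (map f (repeat m xs)) ≡ product (map f xs) ^ m
product-map-repeat f zero xs = refl
product-map-repeat f (suc m) xs =
  trans (cong product (map-++ f xs (repeat m xs)))
        (trans (product-++ (map f xs) _) (cong (product (map f xs) *_) (product-map-repeat f m xs)))

module _ (f : A → B → C) (p : C → Bool) where

  countᵇ-zipWithˡ : (g : A → Bool) → (∀ x y → p (f x y) ≡ g x) →
    ∀ xs ys → length xs ≡ length ys → countᵇ p (zipWith f xs ys) ≡ countᵇ g xs
  countᵇ-zipWithˡ g pf≡g [] [] _ = refl
  countᵇ-zipWithˡ g pf≡g (x ∷ xs) (y ∷ ys) |xs|≡|ys| =
    cong₂ _+_ (cong toℕ (pf≡g x y)) (countᵇ-zipWithˡ g pf≡g xs ys (suc-injective |xs|≡|ys|))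

  countᵇ-zipWithʳ : (g : B → Bool) → (∀ x y → p (f x y) ≡ g y) →
    ∀ xs ys → length xs ≡ length ys → countᵇ p (zipWith f xs ys) ≡ countᵇ g ys
  countᵇ-zipWithʳ g pf≡g [] [] _ = refl
  countᵇ-zipWithʳ g pf≡g (x ∷ xs) (y ∷ ys) |xs|≡|ys| =
    cong₂ _+_ (cong toℕ (pf≡g x y)) (countᵇ-zipWithʳ g pf≡g xs ys (suc-injective |xs|≡|ys|))

  countᵇ-zipWith≤ : (g : A → Bool) → (∀ x y → p (f x y) ≡ true → g x ≡ true) →
    ∀ xs ys → countᵇ p (zipWith f xs ys) ≤ countᵇ g xs
  countᵇ-zipWith≤ g pf⇒g [] ys = z≤n
  countᵇ-zipWith≤ g pf⇒g (x ∷ xs) [] = z≤n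
  countᵇ-zipWith≤ g pf⇒g (x ∷ xs) (y ∷ ys) = +-mono-≤ (toℕ-mono (pf⇒g x y)) (countᵇ-zipWith≤ g pf⇒g xs ys)
    where
    toℕ-mono : ∀ {s t} → (s ≡ true → t ≡ true) → toℕ s ≤ toℕ t
    toℕ-mono {false} s⇒t = z≤n
    toℕ-mono {true} s⇒t rewrite s⇒t refl = ≤-refl

does-⇔ : ∀ {p q} {P : Set p} {Q : Set q} → P ⇔ Q → (P? : Dec P) (Q? : Dec Q) → does P? ≡ does Q?
does-⇔ P⇔Q (true because _) (true because _) = refl
does-⇔ P⇔Q (false because _) (false because _) = refl
does-⇔ P⇔Q (true because ofʸ p) (false because ofⁿ ¬q) = ⊥-elim (¬q (Equivalence.to P⇔Q p))
does-⇔ P⇔Q (false because ofⁿ ¬p) (true because ofʸ q) = ⊥-elim (¬p (Equivalence.from P⇔Q q))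

T-and⁻ : ∀ {bs} → T (and bs) → All T bs
T-and⁻ {[]} _ = []
T-and⁻ {true ∷ _} t = _ ∷ T-and⁻ t

T-and⁺ : ∀ {bs} → All T bs → T (and bs)
T-and⁺ [] = _
T-and⁺ {true ∷ _} (_ ∷ ts) = T-and⁺ ts

concatMap-map≡cartesianProductWith : (f : A → B → C) (xs : List A) (ys : List B) →
  concatMap (λ x → map (f x) ys) xs ≡ cartesianProductWith f xs ys
concatMap-map≡cartesianProductWith f [] ys = refl
concatMap-map≡cartesianProductWith f (x ∷ xs) ys =
  cong (map (f x) ys ++_) (concatMap-map≡cartesianProductWith f xs ys)

Unique-map⁺ : {f : A → B} {xs : List A} → (∀ {x y} → x ∈ xs → y ∈ xs → f x ≡ f y → x ≡ y) →
  Unique xs → Unique (map f xs)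
Unique-map⁺ inj [] = []
Unique-map⁺ inj (x∉xs ∷ xs!) =
  All.map⁺ (All.tabulate (λ y∈xs fx≡fy → All.lookup x∉xs y∈xs (inj (here refl) (there y∈xs) fx≡fy)))
  ∷ Unique-map⁺ (λ x∈ y∈ → inj (there x∈) (there y∈)) xs!

Unique-cartesianProductWith⁺ : (f : A → B → C) {xs : List A} {ys : List B} →
  (∀ {w x y z} → w ∈ xs → x ∈ xs → y ∈ ys → z ∈ ys → f w y ≡ f x z → w ≡ x × y ≡ z) →
  Unique xs → Unique ys → Unique (cartesianProductWith f xs ys)
Unique-cartesianProductWith⁺ f inj [] ys! = []
Unique-cartesianProductWith⁺ f {x ∷ xs} {ys} inj (x∉xs ∷ xs!) ys! =
  Unique.++⁺ (Unique-map⁺ (λ y∈ z∈ → proj₂ ∘ inj (here refl) (here refl) y∈ z∈) ys!)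
             (Unique-cartesianProductWith⁺ f (λ w∈ x∈ → inj (there w∈) (there x∈)) xs! ys!)
             disjoint
  where
  disjoint : ∀ {v} → ¬ (v ∈ map (f x) ys × v ∈ cartesianProductWith f xs ys)
  disjoint (v∈head , v∈rest) with ∈-map⁻ (f x) v∈head | ∈-cartesianProductWith⁻ f xs ys v∈rest
  ... | y , y∈ys , refl | x′ , z , x′∈xs , z∈ys , eq =
    All.lookup x∉xs x′∈xs (proj₁ (inj (here refl) (there x′∈xs) y∈ys z∈ys eq))

module Counting {a} {A : Set a} (_≟_ : DecidableEquality A) where

  _≟ᵇ_ : A → A → Bool
  x ≟ᵇ y = does (x ≟ y)

  count : A → List A → ℕ
  count x = countᵇ (x ≟ᵇ_)

  Enumerates : List A → Set a
  Enumerates E = ∀ x → count x E ≡ 1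

  ≟ᵇ-refl : ∀ x → x ≟ᵇ x ≡ true
  ≟ᵇ-refl x = dec-true (x ≟ x) refl

  ≟ᵇ-≢ : ∀ {x y} → x ≢ y → x ≟ᵇ y ≡ false
  ≟ᵇ-≢ {x} {y} = dec-false (x ≟ y)

  ≟ᵇ-sym : ∀ x y → x ≟ᵇ y ≡ y ≟ᵇ x
  ≟ᵇ-sym x y with x ≟ y
  ... | yes refl = sym (≟ᵇ-refl x)
  ... | no x≢y = sym (≟ᵇ-≢ (x≢y ∘ sym))

  ≟ᵇ⇒≡ : ∀ {x y} → x ≟ᵇ y ≡ true → x ≡ y
  ≟ᵇ⇒≡ {x} {y} eq with x ≟ y
  ... | yes x≡y = x≡y

  count-∉ : ∀ {x xs} → x ∉ xs → count x xs ≡ 0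
  count-∉ {xs = []} x∉xs = refl
  count-∉ {x} {y ∷ xs} x∉xs
    rewrite ≟ᵇ-≢ (x∉xs ∘ here) = count-∉ (x∉xs ∘ there)

  unique⇒count≡1 : ∀ {x xs} → Unique xs → x ∈ xs → count x xs ≡ 1
  unique⇒count≡1 {x} (x∉xs ∷ _) (here refl)
    rewrite ≟ᵇ-refl x = cong suc (count-∉ (λ x∈xs → All.lookup x∉xs x∈xs refl))
  unique⇒count≡1 {x} (y∉xs ∷ xs!) (there x∈xs)
    rewrite ≟ᵇ-≢ (λ x≡y → All.lookup y∉xs x∈xs (sym x≡y)) = unique⇒count≡1 xs! x∈xs

  count-++ : ∀ x xs ys → count x (xs ++ ys) ≡ count x xs + count x ys
  count-++ x = sum-map-++ (toℕ ∘ (x ≟ᵇ_))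

  count-replicate : ∀ x c → count x (replicate c x) ≡ c
  count-replicate x zero = refl
  count-replicate x (suc c) rewrite ≟ᵇ-refl x = cong suc (count-replicate x c)

  count-replicate-≢ : ∀ {x y} c → x ≢ y → count x (replicate c y) ≡ 0
  count-replicate-≢ zero x≢y = refl
  count-replicate-≢ (suc c) x≢y rewrite ≟ᵇ-≢ x≢y = count-replicate-≢ c x≢y

  count-concat-replicate-∉ : ∀ {x} μ E → x ∉ E → count x (concat (zipWith replicate μ E)) ≡ 0
  count-concat-replicate-∉ [] E x∉E = refl
  count-concat-replicate-∉ (c ∷ μ) [] x∉E = refl
  count-concat-replicate-∉ {x} (c ∷ μ) (e ∷ E) x∉E = begin
    count x (replicate c e ++ concat (zipWith replicate μ E))
      ≡⟨ count-++ x (replicate c e) _ ⟩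
    count x (replicate c e) + count x (concat (zipWith replicate μ E))
      ≡⟨ cong₂ _+_ (count-replicate-≢ c (x∉E ∘ here)) (count-concat-replicate-∉ μ E (x∉E ∘ there)) ⟩
    0 ∎
    where open ≡-Reasoning

  map-count-concat-replicate : ∀ μ {E} → Unique E → length μ ≡ length E →
    map (λ x → count x (concat (zipWith replicate μ E))) E ≡ μ
  map-count-concat-replicate [] {[]} _ _ = refl
  map-count-concat-replicate (c ∷ μ) {e ∷ E} (e∉E ∷ E!) |μ|≡|E| = cong₂ _∷_ head≡ tail≡
    where
    rest : List A
    rest = concat (zipWith replicate μ E)
    head≡ : count e (replicate c e ++ rest) ≡ c
    head≡ = begin
      count e (replicate c e ++ rest)           ≡⟨ count-++ e (replicate c e) rest ⟩
      count e (replicate c e) + count e rest    ≡⟨ cong₂ _+_ (count-replicate e c)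
                                                     (count-concat-replicate-∉ μ E (λ e∈E → All.lookup e∉E e∈E refl)) ⟩
      c + 0                                     ≡⟨ +-identityʳ c ⟩
      c ∎
      where open ≡-Reasoning
    tail≡ : map (λ x → count x (replicate c e ++ rest)) E ≡ μ
    tail≡ = trans (map-cong-local (All.tabulate λ {x} x∈E →
                     trans (count-++ x (replicate c e) rest)
                           (cong (_+ count x rest) (count-replicate-≢ c (λ x≡e → All.lookup e∉E x∈E (sym x≡e))))))
                  (map-count-concat-replicate μ E! (suc-injective |μ|≡|E|))

  sum-map-*-≟ᵇ : (g : A → ℕ) (x : A) (E : List A) →
    sum (map (λ α → g α * toℕ (α ≟ᵇ x)) E) ≡ g x * count x E
  sum-map-*-≟ᵇ g x [] = sym (*-zeroʳ (g x))
  sum-map-*-≟ᵇ g x (α ∷ E) rewrite ≟ᵇ-sym α x | sum-map-*-≟ᵇ g x E with x ≟ α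
  ... | yes refl = sym (*-distribˡ-+ (g x) 1 (count x E))
  ... | no _ = cong (_+ g x * count x E) (*-zeroʳ (g α))

  product-map-^-≟ᵇ : (h : A → ℕ) (x : A) (E : List A) →
    product (map (λ α → h α ^ toℕ (α ≟ᵇ x)) E) ≡ h x ^ count x E
  product-map-^-≟ᵇ h x [] = refl
  product-map-^-≟ᵇ h x (α ∷ E) rewrite ≟ᵇ-sym α x | product-map-^-≟ᵇ h x E with x ≟ α
  ... | yes refl = sym (^-distribˡ-+-* (h x) 1 (count x E))
  ... | no _ = +-identityʳ (h x ^ count x E)

  module _ (E : List A) (E-enum : Enumerates E) where

    sum-map-*-count : (g : A → ℕ) (X : List A) → sum (map (λ α → g α * count α X) E) ≡ sum (map g X)
    sum-map-*-count g [] = trans (sum-map-cong E (λ {α} _ → *-zeroʳ (g α))) (trans (sum-map-const 0 E) (*-zeroʳ (length E)))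
    sum-map-*-count g (x ∷ X) = begin
      sum (map (λ α → g α * (toℕ (α ≟ᵇ x) + count α X)) E)
        ≡⟨ sum-map-cong E (λ {α} _ → *-distribˡ-+ (g α) (toℕ (α ≟ᵇ x)) (count α X)) ⟩
      sum (map (λ α → g α * toℕ (α ≟ᵇ x) + g α * count α X) E)
        ≡⟨ sum-map-+ _ _ E ⟩
      sum (map (λ α → g α * toℕ (α ≟ᵇ x)) E) + sum (map (λ α → g α * count α X) E)
        ≡⟨ cong₂ _+_ (trans (sum-map-*-≟ᵇ g x E) (trans (cong (g x *_) (E-enum x)) (*-identityʳ (g x))))
                     (sum-map-*-count g X) ⟩
      g x + sum (map g X) ∎
      where open ≡-Reasoning

    product-map-^-count : (h : A → ℕ) (X : List A) → product (map (λ α → h α ^ count α X) E) ≡ product (map h X)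
    product-map-^-count h [] = trans (product-map-const 1 E) (^-zeroˡ (length E))
    product-map-^-count h (x ∷ X) = begin
      product (map (λ α → h α ^ (toℕ (α ≟ᵇ x) + count α X)) E)
        ≡⟨ product-map-cong E (λ {α} _ → ^-distribˡ-+-* (h α) (toℕ (α ≟ᵇ x)) (count α X)) ⟩
      product (map (λ α → h α ^ toℕ (α ≟ᵇ x) * h α ^ count α X) E)
        ≡⟨ product-map-* _ _ E ⟩
      product (map (λ α → h α ^ toℕ (α ≟ᵇ x)) E) * product (map (λ α → h α ^ count α X) E)
        ≡⟨ cong₂ _*_ (trans (product-map-^-≟ᵇ h x E) (trans (cong (h x ^_) (E-enum x)) (*-identityʳ (h x))))
                     (product-map-^-count h X) ⟩
      h x * product (map h X) ∎
      where open ≡-Reasoning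

-- Enumerations of indices, multiplicity vectors and words

module Letter {m : ℕ} = Counting (Fin._≟_ {m})

module Idx {D n : ℕ} = Counting (≡-dec {n = D} (Fin._≟_ {n}))

allFin-enumerates : ∀ n → Letter.Enumerates (allFin n)
allFin-enumerates n v = Letter.unique⇒count≡1 (Unique.allFin⁺ n) (∈-allFin v)

bounded-suc : ∀ b N → bounded b (suc N) ≡ cartesianProductWith _∷_ (upTo (suc b)) (bounded b N)
bounded-suc b N = concatMap-map≡cartesianProductWith _∷_ (upTo (suc b)) (bounded b N)

∈-bounded⁺ : ∀ {b} μ → All (_≤ b) μ → μ ∈ bounded b (length μ)
∈-bounded⁺ [] [] = here refl
∈-bounded⁺ {b} (m ∷ μ) (m≤b ∷ μ≤b) = subst (m ∷ μ ∈_) (sym (bounded-suc b (length μ)))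
  (∈-cartesianProductWith⁺ _∷_ (∈-upTo⁺ (s≤s m≤b)) (∈-bounded⁺ μ μ≤b))

∈-bounded⁻ : ∀ {b} N {μ} → μ ∈ bounded b N → length μ ≡ N × All (_≤ b) μ
∈-bounded⁻ zero (here refl) = refl , []
∈-bounded⁻ {b} (suc N) μ∈
  with ∈-cartesianProductWith⁻ _∷_ (upTo (suc b)) (bounded b N) (subst (_ ∈_) (bounded-suc b N) μ∈)
... | m , ν , m∈ , ν∈ , refl with ∈-bounded⁻ N ν∈
...   | refl , ν≤b = refl , ≤-pred (∈-upTo⁻ m∈) ∷ ν≤b

Unique-bounded : ∀ b N → Unique (bounded b N)
Unique-bounded b zero = [] ∷ []
Unique-bounded b (suc N) = subst Unique (sym (bounded-suc b N))
  (Unique-cartesianProductWith⁺ _∷_ (λ _ _ _ _ → ∷-injective) (Unique.upTo⁺ (suc b)) (Unique-bounded b N))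

indices-suc : ∀ D n → indices (suc D) n ≡ cartesianProductWith Vec._∷_ (allFin n) (indices D n)
indices-suc D n = concatMap-map≡cartesianProductWith Vec._∷_ (allFin n) (indices D n)

∈-indices : ∀ {D n} (α : Index D n) → α ∈ indices D n
∈-indices Vec.[] = here refl
∈-indices {suc D} {n} (i Vec.∷ α) = subst (_ ∈_) (sym (indices-suc D n))
  (∈-cartesianProductWith⁺ Vec._∷_ (∈-allFin i) (∈-indices α))

Unique-indices : ∀ D n → Unique (indices D n)
Unique-indices zero n = [] ∷ []
Unique-indices (suc D) n = subst Unique (sym (indices-suc D n))
  (Unique-cartesianProductWith⁺ Vec._∷_ (λ _ _ _ _ → ∷-injectiveᵛ) (Unique.allFin⁺ n) (Unique-indices D n))

indices-enumerates : ∀ D n → Idx.Enumerates (indices D n)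
indices-enumerates D n α = Idx.unique⇒count≡1 (Unique-indices D n) (∈-indices α)

words : (m L : ℕ) → List (List (Fin m))
words m zero = [ [] ]
words m (suc L) = cartesianProductWith _∷_ (allFin m) (words m L)

∈-words⁻ : ∀ {m} L {a} → a ∈ words m L → length a ≡ L
∈-words⁻ zero (here refl) = refl
∈-words⁻ {m} (suc L) a∈ with ∈-cartesianProductWith⁻ _∷_ (allFin m) (words m L) a∈
... | v , w , _ , w∈ , refl = cong suc (∈-words⁻ L w∈)

Unique-words : ∀ m L → Unique (words m L)
Unique-words m zero = [] ∷ []
Unique-words m (suc L) =
  Unique-cartesianProductWith⁺ _∷_ (λ _ _ _ _ → ∷-injective) (Unique.allFin⁺ m) (Unique-words m L)

-- Multiplexes as multiplicity vectors and as lists of indices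

T-isMultiplex⁻ : ∀ {D n k μ} → T (isMultiplex D n k μ) →
  sum μ ≡ k * n × (∀ i v → hyperCount i v (zip (indices D n) μ) ≡ k)
T-isMultiplex⁻ t with Equivalence.to T-∧ t
... | t₁ , t₂ = ≡ᵇ⇒≡ _ _ t₁ , λ i v →
  ≡ᵇ⇒≡ _ _ (All.tabulate⁻ (All.map⁻ (All.tabulate⁻ (All.map⁻ (All.concat⁻ (T-and⁻ t₂))) i)) v)

T-isMultiplex⁺ : ∀ {D n k μ} → sum μ ≡ k * n → (∀ i v → hyperCount i v (zip (indices D n) μ) ≡ k) →
  T (isMultiplex D n k μ)
T-isMultiplex⁺ sum≡ hyperCount≡ = Equivalence.from T-∧
  ( ≡⇒≡ᵇ _ _ sum≡
  , T-and⁺ (All.concat⁺ (All.map⁺ (All.tabulate⁺ λ i → All.map⁺ (All.tabulate⁺ λ v → ≡⇒≡ᵇ _ _ (hyperCount≡ i v))))))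

-- PerB b k A is by definition the sum of weight A over this list; μ is read against `indices D n`.
multiplexes : (D n b k : ℕ) → List (List ℕ)
multiplexes D n b k = filter (λ μ → isMultiplex D n k μ Bool.≟ true) (bounded b (length (indices D n)))

record IsMultiplex (D n b k : ℕ) (μ : List ℕ) : Set where
  field
    length≡ : length μ ≡ length (indices D n)
    entries≤ : All (_≤ b) μ
    sum≡ : sum μ ≡ k * n
    hyperCount≡ : ∀ i v → hyperCount i v (zip (indices D n) μ) ≡ k

module _ {D n b k : ℕ} where

  ∈-multiplexes⁻ : ∀ {μ} → μ ∈ multiplexes D n b k → IsMultiplex D n b k μ
  ∈-multiplexes⁻ μ∈ with ∈-filter⁻ (λ μ → isMultiplex D n k μ Bool.≟ true) μ∈
  ... | μ∈bounded , isMux with ∈-bounded⁻ _ μ∈bounded | T-isMultiplex⁻ (Equivalence.from T-≡ isMux)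
  ...   | length≡ , entries≤ | sum≡ , hyperCount≡ = record
    { length≡ = length≡ ; entries≤ = entries≤ ; sum≡ = sum≡ ; hyperCount≡ = hyperCount≡ }

  ∈-multiplexes⁺ : ∀ {μ} → IsMultiplex D n b k μ → μ ∈ multiplexes D n b k
  ∈-multiplexes⁺ {μ} μ-mux = ∈-filter⁺ (λ μ → isMultiplex D n k μ Bool.≟ true)
    (subst (λ N → μ ∈ bounded b N) length≡ (∈-bounded⁺ μ entries≤))
    (Equivalence.to T-≡ (T-isMultiplex⁺ sum≡ hyperCount≡))
    where open IsMultiplex μ-mux

  Unique-multiplexes : Unique (multiplexes D n b k)
  Unique-multiplexes = Unique.filter⁺ (λ μ → isMultiplex D n k μ Bool.≟ true) (Unique-bounded b (length (indices D n)))

module _ {D n : ℕ} where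
  open Idx {D} {n}

  onHyperplane : Fin D → Fin n → Index D n → Bool
  onHyperplane i v α = does (lookup α i Fin.≟ v)

  multiplicities : List (Index D n) → List ℕ
  multiplicities X = map (λ α → count α X) (indices D n)

  elements : List ℕ → List (Index D n)
  elements μ = concat (zipWith replicate μ (indices D n))

  record IsMultiplexList (b k : ℕ) (X : List (Index D n)) : Set where
    field
      length≡ : length X ≡ k * n
      count≤ : ∀ α → count α X ≤ b
      onHyperplane≡ : ∀ i v → countᵇ (onHyperplane i v) X ≡ k

  private
    E-enum : Enumerates (indices D n)
    E-enum = indices-enumerates D n

  hyperCount-multiplicities : ∀ i v X →
    hyperCount i v (zip (indices D n) (multiplicities X)) ≡ countᵇ (onHyperplane i v) X
  hyperCount-multiplicities i v X = begin
    hyperCount i v (zip (indices D n) (multiplicities X))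
      ≡⟨ cong (hyperCount i v) (zip-map-self (λ α → count α X) (indices D n)) ⟩
    hyperCount i v (map (λ α → α , count α X) (indices D n))
      ≡⟨ sum-map-proj₂-filter (λ α → lookup α i Fin.≟ v) (map (λ α → α , count α X) (indices D n)) ⟩
    sum (map (λ (α , m) → toℕ (onHyperplane i v α) * m) (map (λ α → α , count α X) (indices D n)))
      ≡⟨ cong sum (map-∘ (indices D n)) ⟨
    sum (map (λ α → toℕ (onHyperplane i v α) * count α X) (indices D n))
      ≡⟨ sum-map-*-count (indices D n) E-enum (toℕ ∘ onHyperplane i v) X ⟩
    countᵇ (onHyperplane i v) X ∎
    where open ≡-Reasoning

  weight-multiplicities : ∀ (A : Array D n) X → weight A (multiplicities X) ≡ product (map A X)
  weight-multiplicities A X = begin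
    product (map (λ (α , m) → A α ^ m) (zip (indices D n) (multiplicities X)))
      ≡⟨ cong (product ∘ map (λ (α , m) → A α ^ m)) (zip-map-self (λ α → count α X) (indices D n)) ⟩
    product (map (λ (α , m) → A α ^ m) (map (λ α → α , count α X) (indices D n)))
      ≡⟨ cong product (map-∘ (indices D n)) ⟨
    product (map (λ α → A α ^ count α X) (indices D n))
      ≡⟨ product-map-^-count (indices D n) E-enum A X ⟩
    product (map A X) ∎
    where open ≡-Reasoning

  sum-multiplicities : ∀ X → sum (multiplicities X) ≡ length X
  sum-multiplicities X = begin
    sum (map (λ α → count α X) (indices D n))       ≡⟨ sum-map-cong (indices D n) (λ _ → *-identityˡ _) ⟨
    sum (map (λ α → 1 * count α X) (indices D n))   ≡⟨ sum-map-*-count (indices D n) E-enum (λ _ → 1) X ⟩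
    sum (map (λ _ → 1) X)                           ≡⟨ sum-map-const 1 X ⟩
    length X * 1                                    ≡⟨ *-identityʳ _ ⟩
    length X ∎
    where open ≡-Reasoning

  multiplicities-elements : ∀ μ → length μ ≡ length (indices D n) → multiplicities (elements μ) ≡ μ
  multiplicities-elements μ = map-count-concat-replicate μ (Unique-indices D n)

  count-elements≤ : ∀ {b μ} → length μ ≡ length (indices D n) → All (_≤ b) μ → ∀ α → count α (elements μ) ≤ b
  count-elements≤ {μ = μ} |μ| μ≤b α =
    All.lookup (All.map⁻ (subst (All _) (sym (multiplicities-elements μ |μ|)) μ≤b)) (∈-indices α)

  multiplicities-isMultiplex : ∀ {b k X} → IsMultiplexList b k X → IsMultiplex D n b k (multiplicities X)
  multiplicities-isMultiplex {b} {k} {X} X-mux = record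
    { length≡ = length-map _ (indices D n)
    ; entries≤ = All.map⁺ (All.tabulate λ {α} _ → count≤ α)
    ; sum≡ = trans (sum-multiplicities X) length≡
    ; hyperCount≡ = λ i v → trans (hyperCount-multiplicities i v X) (onHyperplane≡ i v)
    }
    where open IsMultiplexList X-mux

  elements-isMultiplexList : ∀ {b k μ} → IsMultiplex D n b k μ → IsMultiplexList b k (elements μ)
  elements-isMultiplexList {b} {k} {μ} μ-mux = record
    { length≡ = trans (sym (sum-multiplicities (elements μ))) (trans (cong sum μ≡) sum≡)
    ; count≤ = count-elements≤ length≡ entries≤
    ; onHyperplane≡ = λ i v → trans (sym (hyperCount-multiplicities i v (elements μ)))
                                    (trans (cong (hyperCount i v ∘ zip (indices D n)) μ≡) (hyperCount≡ i v))
    }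
    where
    open IsMultiplex μ-mux
    μ≡ : multiplicities (elements μ) ≡ μ
    μ≡ = multiplicities-elements μ length≡

module _ {D n : ℕ} where

  count-≡⇒countᵇ-≡ : ∀ X Y → (∀ β → Idx.count β X ≡ Idx.count β Y) → ∀ p → countᵇ p X ≡ countᵇ p Y
  count-≡⇒countᵇ-≡ X Y X≈Y p = begin
    countᵇ p X
      ≡⟨ sum-map-*-count′ X ⟨
    sum (map (λ β → toℕ (p β) * Idx.count β X) (indices D n))
      ≡⟨ sum-map-cong (indices D n) (λ {β} _ → cong (toℕ (p β) *_) (X≈Y β)) ⟩
    sum (map (λ β → toℕ (p β) * Idx.count β Y) (indices D n))
      ≡⟨ sum-map-*-count′ Y ⟩
    countᵇ p Y ∎
    where
    open ≡-Reasoning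
    sum-map-*-count′ : ∀ Z → sum (map (λ β → toℕ (p β) * Idx.count β Z) (indices D n)) ≡ countᵇ p Z
    sum-map-*-count′ = Idx.sum-map-*-count (indices D n) (indices-enumerates D n) (toℕ ∘ p)

  multiplicities-injective : ∀ {X Y : List (Index D n)} → multiplicities X ≡ multiplicities Y →
    ∀ β → Idx.count β X ≡ Idx.count β Y
  multiplicities-injective eq β = map-≡⇒≡ eq (∈-indices β)

module _ {D n b k : ℕ} (A : Array D n) where

  PerB>0⇒ : PerB b k A > 0 → ∃[ X ] IsMultiplexList b k X × product (map A X) > 0
  PerB>0⇒ PerB>0 with sum-map>0⇒∃ (weight A) (multiplexes D n b k) PerB>0
  ... | μ , μ∈ , weight>0 = elements μ , elements-isMultiplexList μ-mux ,
    subst (_> 0) (trans (cong (weight A) (sym (multiplicities-elements μ (IsMultiplex.length≡ μ-mux))))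
                        (weight-multiplicities A (elements μ))) weight>0
    where
    μ-mux : IsMultiplex D n b k μ
    μ-mux = ∈-multiplexes⁻ μ∈

  ⇒PerB>0 : ∀ {X} → IsMultiplexList b k X → product (map A X) > 0 → PerB b k A > 0
  ⇒PerB>0 {X} X-mux product>0 = <-≤-trans
    (subst (_> 0) (sym (weight-multiplicities A X)) product>0)
    (∈⇒≤sum-map (weight A) (∈-multiplexes⁺ (multiplicities-isMultiplex X-mux)))

  sum-weight≤PerB : ∀ {T} → Unique T → (∀ {μ} → μ ∈ T → IsMultiplex D n b k μ) →
    sum (map (weight A) T) ≤ PerB b k A
  sum-weight≤PerB T! T-mux = sum-map-mono-⊆ (weight A) T! (∈-multiplexes⁺ ∘ T-mux)

repeat-isMultiplexList : ∀ {D n b k X} m → IsMultiplexList {D} {n} b k X → IsMultiplexList (b * m) (k * m) (repeat m X)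
repeat-isMultiplexList {n = n} {k = k} {X} m X-mux = record
  { length≡ = trans (length-repeat m X) (trans (cong (_* m) length≡) (*-Semigroup.xy∙z≈xz∙y k n m))
  ; count≤ = λ α → subst (_≤ _) (sym (countᵇ-repeat _ m X)) (*-monoˡ-≤ m (count≤ α))
  ; onHyperplane≡ = λ i v → trans (countᵇ-repeat _ m X) (cong (_* m) (onHyperplane≡ i v))
  }
  where open IsMultiplexList X-mux

Per>0⇒Per-multiple>0 : ∀ {D n} (A : Array D n) (k m : ℕ) → Per k A > 0 → Per (k * m) A > 0
Per>0⇒Per-multiple>0 {n = n} A k m Per>0 with PerB>0⇒ A Per>0
... | X , X-mux , product>0 = ⇒PerB>0 A
  (subst (λ b → IsMultiplexList b (k * m) (repeat m X)) (*-Semigroup.xy∙z≈xz∙y k n m) (repeat-isMultiplexList m X-mux))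
  (subst (_> 0) (sym (product-map-repeat A m X)) (m^n>0 _ {{>-nonZero product>0}} m))

-- Words with prescribed letter multiplicities

module _ {m : ℕ} where
  open Letter {m}

  HasContent : (Fin m → ℕ) → List (Fin m) → Set
  HasContent c a = ∀ v → count v a ≡ c v

  hasContent? : ∀ c → Decidable (HasContent c)
  hasContent? c a = all? (λ v → count v a ≟ c v)

  total : (Fin m → ℕ) → ℕ
  total c = sum (map c (allFin m))

  factorials : (Fin m → ℕ) → ℕ
  factorials c = product (map (λ u → c u !) (allFin m))

  decrement : Fin m → (Fin m → ℕ) → Fin m → ℕ
  decrement v c u = c u ∸ toℕ (u ≟ᵇ v)

  module _ {c : Fin m → ℕ} {v : Fin m} (cv≥1 : c v ≥ 1) where

    ≟ᵇ≤ : ∀ u → toℕ (u ≟ᵇ v) ≤ c u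
    ≟ᵇ≤ u with u Fin.≟ v
    ... | yes refl = cv≥1
    ... | no _ = z≤n

    hasContent-∷⇔ : ∀ {w} → HasContent c (v ∷ w) ⇔ HasContent (decrement v c) w
    hasContent-∷⇔ {w} = mk⇔
      (λ content u → trans (sym (m+n∸m≡n (toℕ (u ≟ᵇ v)) (count u w))) (cong (_∸ toℕ (u ≟ᵇ v)) (content u)))
      (λ content u → trans (cong (toℕ (u ≟ᵇ v) +_) (content u)) (m+[n∸m]≡n (≟ᵇ≤ u)))

    total-decrement : total c ≡ suc (total (decrement v c))
    total-decrement = begin
      sum (map c (allFin m))
        ≡⟨ sum-map-cong (allFin m) (λ {u} _ → sym (m∸n+n≡m (≟ᵇ≤ u))) ⟩
      sum (map (λ u → decrement v c u + toℕ (u ≟ᵇ v)) (allFin m))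
        ≡⟨ sum-map-+ (decrement v c) (toℕ ∘ (_≟ᵇ v)) (allFin m) ⟩
      total (decrement v c) + sum (map (λ u → toℕ (u ≟ᵇ v)) (allFin m))
        ≡⟨ cong (total (decrement v c) +_) number-of-v ⟩
      total (decrement v c) + 1
        ≡⟨ +-comm _ 1 ⟩
      suc (total (decrement v c)) ∎
      where
      open ≡-Reasoning
      number-of-v : sum (map (λ u → toℕ (u ≟ᵇ v)) (allFin m)) ≡ 1
      number-of-v = begin
        sum (map (λ u → toℕ (u ≟ᵇ v)) (allFin m))      ≡⟨ sum-map-cong (allFin m) (λ _ → *-identityˡ _) ⟨
        sum (map (λ u → 1 * toℕ (u ≟ᵇ v)) (allFin m))  ≡⟨ sum-map-*-≟ᵇ (λ _ → 1) v (allFin m) ⟩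
        1 * count v (allFin m)                          ≡⟨ *-identityˡ _ ⟩
        count v (allFin m)                              ≡⟨ allFin-enumerates m v ⟩
        1 ∎

    factorials-decrement : factorials c ≡ factorials (decrement v c) * c v
    factorials-decrement = begin
      product (map (λ u → c u !) (allFin m))
        ≡⟨ product-map-cong (allFin m) (λ {u} _ → factorial≡ u) ⟩
      product (map (λ u → decrement v c u ! * c v ^ toℕ (u ≟ᵇ v)) (allFin m))
        ≡⟨ product-map-* _ _ (allFin m) ⟩
      factorials (decrement v c) * product (map (λ u → c v ^ toℕ (u ≟ᵇ v)) (allFin m))
        ≡⟨ cong (factorials (decrement v c) *_) power-of-v ⟩
      factorials (decrement v c) * c v ∎
      where
      open ≡-Reasoning
      factorial≡ : ∀ u → c u ! ≡ decrement v c u ! * c v ^ toℕ (u ≟ᵇ v)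
      factorial≡ u with u Fin.≟ v
      ... | no _ = sym (*-identityʳ _)
      ... | yes refl = unfold-! (c u) cv≥1
        where
        unfold-! : ∀ x → x ≥ 1 → x ! ≡ (x ∸ 1) ! * x ^ 1
        unfold-! (suc t) _ = trans (*-comm (suc t) (t !)) (cong (t ! *_) (sym (*-identityʳ (suc t))))
      power-of-v : product (map (λ u → c v ^ toℕ (u ≟ᵇ v)) (allFin m)) ≡ c v
      power-of-v = trans (product-map-^-≟ᵇ (λ _ → c v) v (allFin m))
                         (trans (cong (c v ^_) (allFin-enumerates m v)) (*-identityʳ (c v)))

  countᵇ-hasContent-∷≡0 : ∀ {c v} → c v ≡ 0 → ∀ W → countᵇ (λ w → does (hasContent? c (v ∷ w))) W ≡ 0
  countᵇ-hasContent-∷≡0 {c} {v} cv≡0 W = begin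
    countᵇ (λ w → does (hasContent? c (v ∷ w))) W
      ≡⟨ sum-map-cong W (λ {w} _ → cong toℕ (dec-false (hasContent? c (v ∷ w)) (no-v {w}))) ⟩
    sum (map (λ _ → 0) W)   ≡⟨ sum-map-const 0 W ⟩
    length W * 0            ≡⟨ *-zeroʳ (length W) ⟩
    0 ∎
    where
    open ≡-Reasoning
    no-v : ∀ {w} → ¬ HasContent c (v ∷ w)
    no-v {w} content = 1+n≢0 (trans (cong (λ b → toℕ b + count v w) (sym (≟ᵇ-refl v))) (trans (content v) cv≡0))

  countᵇ-hasContent-∷ : ∀ {c v} → c v ≥ 1 → ∀ W →
    countᵇ (λ w → does (hasContent? c (v ∷ w))) W ≡ countᵇ (does ∘ hasContent? (decrement v c)) W
  countᵇ-hasContent-∷ {c} {v} cv≥1 W = sum-map-cong W λ {w} _ →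
    cong toℕ (does-⇔ (hasContent-∷⇔ cv≥1 {w}) (hasContent? c (v ∷ w)) (hasContent? (decrement v c) w))

  multinomial : ∀ L c → total c ≡ L → countᵇ (does ∘ hasContent? c) (words m L) * factorials c ≡ L !
  multinomial zero c total≡0 =
    cong₂ _*_ (trans (+-identityʳ _) (cong toℕ (dec-true (hasContent? c []) λ u → sym (c≡0 u)))) factorials≡1
    where
    c≡0 : ∀ u → c u ≡ 0
    c≡0 u = n≤0⇒n≡0 (subst (c u ≤_) total≡0 (∈⇒≤sum-map c (∈-allFin u)))
    factorials≡1 : factorials c ≡ 1
    factorials≡1 = trans (product-map-cong (allFin m) (λ {u} _ → cong _! (c≡0 u)))
                         (trans (product-map-const 1 (allFin m)) (^-zeroˡ (length (allFin m))))
  multinomial (suc L) c total≡1+L = begin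
    countᵇ (does ∘ hasContent? c) (words m (suc L)) * factorials c
      ≡⟨ cong (_* factorials c) (sum-map-cartesianProductWith (toℕ ∘ does ∘ hasContent? c) _∷_ (allFin m) (words m L)) ⟩
    sum (map starting-with (allFin m)) * factorials c
      ≡⟨ sum-map-*ʳ starting-with (factorials c) (allFin m) ⟨
    sum (map (λ v → starting-with v * factorials c) (allFin m))
      ≡⟨ sum-map-cong (allFin m) (λ {v} _ → starting-with≡ v) ⟩
    sum (map (λ v → c v * L !) (allFin m))
      ≡⟨ sum-map-*ʳ c (L !) (allFin m) ⟩
    total c * L !
      ≡⟨ cong (_* L !) total≡1+L ⟩
    suc L ! ∎
    where
    open ≡-Reasoning
    starting-with : Fin m → ℕ
    starting-with v = countᵇ (λ w → does (hasContent? c (v ∷ w))) (words m L)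
    starting-with≡ : ∀ v → starting-with v * factorials c ≡ c v * L !
    starting-with≡ v with c v in cv≡
    ... | zero = cong (_* factorials c) (countᵇ-hasContent-∷≡0 cv≡ (words m L))
    ... | suc t = begin
      starting-with v * factorials c
        ≡⟨ cong₂ _*_ (countᵇ-hasContent-∷ cv≥1 (words m L)) (factorials-decrement cv≥1) ⟩
      N′ * (factorials (decrement v c) * c v)      ≡⟨ *-assoc N′ _ _ ⟨
      N′ * factorials (decrement v c) * c v        ≡⟨ cong (_* c v) (multinomial L (decrement v c) total≡L) ⟩
      L ! * c v                                    ≡⟨ *-comm (L !) (c v) ⟩
      c v * L !                                    ≡⟨ cong (_* L !) cv≡ ⟩
      suc t * L ! ∎
      where
      cv≥1 : c v ≥ 1
      cv≥1 = subst (_≥ 1) (sym cv≡) (s≤s z≤n)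
      N′ : ℕ
      N′ = countᵇ (does ∘ hasContent? (decrement v c)) (words m L)
      total≡L : total (decrement v c) ≡ L
      total≡L = suc-injective (trans (sym (total-decrement cv≥1)) total≡1+L)

balancedWords : (n k : ℕ) → List (List (Fin n))
balancedWords n k = filter (hasContent? (λ _ → k)) (words n (k * n))

module _ {n k : ℕ} where

  ∈-balancedWords⁻ : ∀ {a} → a ∈ balancedWords n k → length a ≡ k * n × HasContent (λ _ → k) a
  ∈-balancedWords⁻ a∈ with ∈-filter⁻ (hasContent? (λ _ → k)) a∈
  ... | a∈words , content = ∈-words⁻ (k * n) a∈words , content

  Unique-balancedWords : Unique (balancedWords n k)
  Unique-balancedWords = Unique.filter⁺ (hasContent? (λ _ → k)) (Unique-words n (k * n))

  length-balancedWords : length (balancedWords n k) * (k !) ^ n ≡ (k * n) !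
  length-balancedWords = begin
    length (balancedWords n k) * (k !) ^ n
      ≡⟨ cong₂ _*_ (length-filter (hasContent? (λ _ → k)) (words n (k * n))) (cong ((k !) ^_) (sym |allFin|)) ⟩
    countᵇ (does ∘ hasContent? (λ _ → k)) (words n (k * n)) * (k !) ^ length (allFin n)
      ≡⟨ cong (countᵇ (does ∘ hasContent? (λ _ → k)) (words n (k * n)) *_) (product-map-const (k !) (allFin n)) ⟨
    countᵇ (does ∘ hasContent? (λ _ → k)) (words n (k * n)) * factorials {n} (λ _ → k)
      ≡⟨ multinomial {n} (k * n) (λ _ → k) total≡ ⟩
    (k * n) ! ∎
    where
    open ≡-Reasoning
    |allFin| : length (allFin n) ≡ n
    |allFin| = length-tabulate (λ i → i)
    total≡ : total {n} (λ _ → k) ≡ k * n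
    total≡ = trans (sum-map-const k (allFin n)) (trans (cong (_* k) |allFin|) (*-comm n k))

  balancedWords-nonEmpty : ∃[ a ] a ∈ balancedWords n k
  balancedWords-nonEmpty with balancedWords n k | length-balancedWords
  ... | a ∷ _ | _ = a , here refl
  ... | [] | 0≡[kn]! = ⊥-elim (<⇒≢ (1≤n! (k * n)) 0≡[kn]!)

-- Lifting multiplexes along the quasigroup

module Quasigroup {n : ℕ} (_∙_ : Fin (suc n) → Fin (suc n) → Fin (suc n)) (q : IsQuasigroup _∙_) where

  one : Fin (suc n)
  one = Fin.zero

  _⧹_ : Fin (suc n) → Fin (suc n) → Fin (suc n)
  a ⧹ b = proj₁ (proj₁ (q a b))

  _⧸_ : Fin (suc n) → Fin (suc n) → Fin (suc n)
  b ⧸ a = proj₁ (proj₂ (q a b))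

  ∙-⧹ : ∀ a b → a ∙ (a ⧹ b) ≡ b
  ∙-⧹ a b = proj₁ (proj₂ (proj₁ (q a b)))

  ⧹≡⇔ : ∀ {a b x} → a ⧹ b ≡ x ⇔ a ∙ x ≡ b
  ⧹≡⇔ {a} {b} = mk⇔ (λ { refl → ∙-⧹ a b }) (proj₂ (proj₂ (proj₁ (q a b))))

  ⧸≡⇔ : ∀ {a b x} → b ⧸ a ≡ x ⇔ x ∙ a ≡ b
  ⧸≡⇔ {a} {b} = mk⇔ (λ { refl → proj₁ (proj₂ (proj₂ (q a b))) }) (proj₂ (proj₂ (proj₂ (q a b))))

  module _ {d : ℕ} where

    extend : Index (suc d) (suc n) → Fin (suc n) → Index (suc (suc (suc d))) (suc n)
    extend (x Vec.∷ xs) y = y Vec.∷ (y ⧹ one) Vec.∷ (one ⧹ x) Vec.∷ xs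

    retract : Index (suc (suc (suc d))) (suc n) → Index (suc d) (suc n)
    retract (_ Vec.∷ _ Vec.∷ w Vec.∷ xs) = (one ∙ w) Vec.∷ xs

    extend-injectiveʳ : ∀ ℓ {y y′} → extend ℓ y ≡ extend ℓ y′ → y ≡ y′
    extend-injectiveʳ (x Vec.∷ xs) eq = proj₁ (∷-injectiveᵛ eq)

    retract-extend : ∀ ℓ y → retract (extend ℓ y) ≡ ℓ
    retract-extend (x Vec.∷ xs) y = cong (Vec._∷ xs) (∙-⧹ one x)

    M-extend : ∀ ℓ y → M _∙_ (suc (suc d)) (extend ℓ y) ≡ M _∙_ d ℓ
    M-extend (x Vec.∷ xs) y rewrite ∙-⧹ y one | ∙-⧹ one x = refl

    lift : List (Index (suc d) (suc n)) → List (Fin (suc n)) → List (Index (suc (suc (suc d))) (suc n))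
    lift = zipWith extend

    product-map-M-lift : ∀ L a → length L ≡ length a →
      product (map (M _∙_ (suc (suc d))) (lift L a)) ≡ product (map (M _∙_ d) L)
    product-map-M-lift [] [] _ = refl
    product-map-M-lift (ℓ ∷ L) (y ∷ a) |L|≡|a| =
      cong₂ _*_ (M-extend ℓ y) (product-map-M-lift L a (suc-injective |L|≡|a|))

    count-lift≤ : ∀ β L a → Idx.count β (lift L a) ≤ Idx.count (retract β) L
    count-lift≤ β = countᵇ-zipWith≤ extend (β Idx.≟ᵇ_) (retract β Idx.≟ᵇ_) λ ℓ y β≡ →
      subst (λ γ → retract β Idx.≟ᵇ γ ≡ true) (trans (cong retract (Idx.≟ᵇ⇒≡ {x = β} β≡)) (retract-extend ℓ y))
        (Idx.≟ᵇ-refl (retract β))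

    count-lift : ∀ ℓ L a → length L ≡ length a →
      Idx.count ℓ L ≡ countᵇ (λ β → ℓ Idx.≟ᵇ retract β) (lift L a)
    count-lift ℓ L a |L|≡|a| = sym (countᵇ-zipWithˡ extend (λ β → ℓ Idx.≟ᵇ retract β) (ℓ Idx.≟ᵇ_)
      (λ ℓ′ y → cong (ℓ Idx.≟ᵇ_) (retract-extend ℓ′ y)) L a |L|≡|a|)

    onHyperplane-lift : ∀ {k} L a → length L ≡ length a →
      (∀ i v → countᵇ (onHyperplane i v) L ≡ k) → (∀ v → Letter.count v a ≡ k) →
      ∀ i v → countᵇ (onHyperplane i v) (lift L a) ≡ k
    onHyperplane-lift L a |L|≡|a| L-hyp a-content Fin.zero v =
      trans (countᵇ-zipWithʳ extend (onHyperplane Fin.zero v) (v Letter.≟ᵇ_)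
               (λ { (x Vec.∷ xs) y → Letter.≟ᵇ-sym y v }) L a |L|≡|a|)
            (a-content v)
    onHyperplane-lift L a |L|≡|a| L-hyp a-content (Fin.suc Fin.zero) v =
      trans (countᵇ-zipWithʳ extend (onHyperplane (Fin.suc Fin.zero) v) ((one ⧸ v) Letter.≟ᵇ_)
               (λ { (x Vec.∷ xs) y → does-⇔ y⧹one≡v⇔ ((y ⧹ one) Fin.≟ v) ((one ⧸ v) Fin.≟ y) }) L a |L|≡|a|)
            (a-content (one ⧸ v))
      where
      y⧹one≡v⇔ : ∀ {y} → y ⧹ one ≡ v ⇔ one ⧸ v ≡ y
      y⧹one≡v⇔ = mk⇔ (Equivalence.from ⧸≡⇔ ∘ Equivalence.to ⧹≡⇔) (Equivalence.from ⧹≡⇔ ∘ Equivalence.to ⧸≡⇔)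
    onHyperplane-lift L a |L|≡|a| L-hyp a-content (Fin.suc (Fin.suc Fin.zero)) v =
      trans (countᵇ-zipWithˡ extend (onHyperplane (Fin.suc (Fin.suc Fin.zero)) v) (onHyperplane Fin.zero (one ∙ v))
               (λ { (x Vec.∷ xs) y → does-⇔ one⧹x≡v⇔ ((one ⧹ x) Fin.≟ v) (x Fin.≟ (one ∙ v)) }) L a |L|≡|a|)
            (L-hyp Fin.zero (one ∙ v))
      where
      one⧹x≡v⇔ : ∀ {x} → one ⧹ x ≡ v ⇔ x ≡ one ∙ v
      one⧹x≡v⇔ = mk⇔ (sym ∘ Equivalence.to ⧹≡⇔) (Equivalence.from ⧹≡⇔ ∘ sym)
    onHyperplane-lift L a |L|≡|a| L-hyp a-content (Fin.suc (Fin.suc (Fin.suc j))) v =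
      trans (countᵇ-zipWithˡ extend (onHyperplane (Fin.suc (Fin.suc (Fin.suc j))) v) (onHyperplane (Fin.suc j) v)
               (λ { (x Vec.∷ xs) y → refl }) L a |L|≡|a|)
            (L-hyp (Fin.suc j) v)

module Lifting {n : ℕ} (_∙_ : Fin (suc n) → Fin (suc n) → Fin (suc n)) (q : IsQuasigroup _∙_) {d k : ℕ} where
  open Quasigroup _∙_ q

  private
    W : List (List (Fin (suc n)))
    W = balancedWords (suc n) k

  lift-isMultiplexList : ∀ {b L a} → IsMultiplexList b k L → a ∈ balancedWords (suc n) k → IsMultiplexList b k (lift {d} L a)
  lift-isMultiplexList {b} {L} {a} L-mux a∈ = record
    { length≡ = trans (length-zipWith extend L a) (trans (cong (_⊓ length a) |L|≡|a|) (trans (⊓-idem (length a)) |a|))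
    ; count≤ = λ β → ≤-trans (count-lift≤ β L a) (count≤ (retract β))
    ; onHyperplane≡ = onHyperplane-lift L a |L|≡|a| onHyperplane≡ content
    }
    where
    open IsMultiplexList L-mux
    |a| : length a ≡ k * suc n
    |a| = proj₁ (∈-balancedWords⁻ {k = k} a∈)
    content : HasContent (λ _ → k) a
    content = proj₂ (∈-balancedWords⁻ {k = k} a∈)
    |L|≡|a| : length L ≡ length a
    |L|≡|a| = trans length≡ (sym |a|)

  -- As L repeats no index, extend ℓ z can occur in lift L a only at the position of ℓ, where z is the letter of a.
  lift-injective : ∀ L a b → length L ≡ length a → length L ≡ length b → (∀ ℓ → Idx.count ℓ L ≤ 1) →
    (∀ β → Idx.count β (lift {d} L a) ≡ Idx.count β (lift L b)) → a ≡ b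
  lift-injective [] [] [] _ _ _ _ = refl
  lift-injective (ℓ ∷ L) (y ∷ a) (y′ ∷ b) |ℓL|≡|ya| |ℓL|≡|y′b| L≤1 same-counts = cong₂ _∷_ y≡y′ a≡b
    where
    ℓ∉L : Idx.count ℓ L ≡ 0
    ℓ∉L = n≤0⇒n≡0 (+-cancelˡ-≤ 1 _ 0 (subst (λ t → toℕ t + Idx.count ℓ L ≤ 1) (Idx.≟ᵇ-refl ℓ) (L≤1 ℓ)))
    fresh : ∀ c → Idx.count (extend ℓ y) (lift L c) ≡ 0
    fresh c = n≤0⇒n≡0 (begin
      Idx.count (extend ℓ y) (lift L c)      ≤⟨ count-lift≤ (extend ℓ y) L c ⟩
      Idx.count (retract (extend ℓ y)) L     ≡⟨ cong (λ γ → Idx.count γ L) (retract-extend ℓ y) ⟩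
      Idx.count ℓ L                          ≡⟨ ℓ∉L ⟩
      0 ∎)
      where open ≤-Reasoning
    count-head : ∀ z c → Idx.count (extend ℓ y) (lift (ℓ ∷ L) (z ∷ c)) ≡ toℕ (extend ℓ y Idx.≟ᵇ extend ℓ z)
    count-head z c = trans (cong (toℕ (extend ℓ y Idx.≟ᵇ extend ℓ z) +_) (fresh c)) (+-identityʳ _)
    y≡y′ : y ≡ y′
    y≡y′ = extend-injectiveʳ ℓ (Idx.≟ᵇ⇒≡ {x = extend ℓ y} (toℕ≡1 (begin
      toℕ (extend ℓ y Idx.≟ᵇ extend ℓ y′)              ≡⟨ count-head y′ b ⟨
      Idx.count (extend ℓ y) (lift (ℓ ∷ L) (y′ ∷ b))   ≡⟨ same-counts (extend ℓ y) ⟨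
      Idx.count (extend ℓ y) (lift (ℓ ∷ L) (y ∷ a))    ≡⟨ count-head y a ⟩
      toℕ (extend ℓ y Idx.≟ᵇ extend ℓ y)               ≡⟨ cong toℕ (Idx.≟ᵇ-refl (extend ℓ y)) ⟩
      1 ∎)))
      where
      open ≡-Reasoning
      toℕ≡1 : ∀ {t} → toℕ t ≡ 1 → t ≡ true
      toℕ≡1 {true} _ = refl
    a≡b : a ≡ b
    a≡b = lift-injective L a b (suc-injective |ℓL|≡|ya|) (suc-injective |ℓL|≡|y′b|)
      (λ ℓ′ → ≤-trans (m≤n+m _ (toℕ (ℓ′ Idx.≟ᵇ ℓ))) (L≤1 ℓ′))
      (λ β → +-cancelˡ-≡ (toℕ (β Idx.≟ᵇ extend ℓ y)) _ _
               (trans (same-counts β) (cong (λ z → toℕ (β Idx.≟ᵇ extend ℓ z) + Idx.count β (lift L b)) (sym y≡y′))))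

  lifted : List ℕ → List (Fin (suc n)) → List ℕ
  lifted μ a = multiplicities (lift {d} (elements μ) a)

  module _ {b μ a} (μ-mux : IsMultiplex (suc d) (suc n) b k μ) (a∈ : a ∈ balancedWords (suc n) k) where

    length-elements≡length : length (elements μ) ≡ length a
    length-elements≡length =
      trans (IsMultiplexList.length≡ (elements-isMultiplexList μ-mux)) (sym (proj₁ (∈-balancedWords⁻ {k = k} a∈)))

    lifted-isMultiplex : IsMultiplex (suc (suc (suc d))) (suc n) b k (lifted μ a)
    lifted-isMultiplex = multiplicities-isMultiplex (lift-isMultiplexList (elements-isMultiplexList μ-mux) a∈)

    weight-lifted : weight (M _∙_ (suc (suc d))) (lifted μ a) ≡ weight (M _∙_ d) μ
    weight-lifted = begin
      weight (M _∙_ (suc (suc d))) (lifted μ a)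
        ≡⟨ weight-multiplicities (M _∙_ (suc (suc d))) (lift (elements μ) a) ⟩
      product (map (M _∙_ (suc (suc d))) (lift (elements μ) a))
        ≡⟨ product-map-M-lift (elements μ) a length-elements≡length ⟩
      product (map (M _∙_ d) (elements μ))
        ≡⟨ weight-multiplicities (M _∙_ d) (elements μ) ⟨
      weight (M _∙_ d) (multiplicities (elements μ))
        ≡⟨ cong (weight (M _∙_ d)) (multiplicities-elements μ (IsMultiplex.length≡ μ-mux)) ⟩
      weight (M _∙_ d) μ ∎
      where open ≡-Reasoning

  lifted-injective : ∀ {μ ν a b} → IsMultiplex (suc d) (suc n) 1 k μ → IsMultiplex (suc d) (suc n) 1 k ν →
    a ∈ balancedWords (suc n) k → b ∈ balancedWords (suc n) k → lifted μ a ≡ lifted ν b → μ ≡ ν × a ≡ b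
  lifted-injective {μ} {ν} {a} {b} μ-mux ν-mux a∈ b∈ eq = μ≡ν , a≡b
    where
    same-counts : ∀ β → Idx.count β (lift (elements μ) a) ≡ Idx.count β (lift (elements ν) b)
    same-counts = multiplicities-injective {X = lift (elements μ) a} {Y = lift (elements ν) b} eq
    μ≡ν : μ ≡ ν
    μ≡ν = begin
      μ                               ≡⟨ multiplicities-elements μ (IsMultiplex.length≡ μ-mux) ⟨
      multiplicities (elements μ)     ≡⟨ map-cong count-elements≡ (indices (suc d) (suc n)) ⟩
      multiplicities (elements ν)     ≡⟨ multiplicities-elements ν (IsMultiplex.length≡ ν-mux) ⟩
      ν ∎
      where
      open ≡-Reasoning
      count-elements≡ : ∀ α → Idx.count α (elements μ) ≡ Idx.count α (elements ν)
      count-elements≡ α = begin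
        Idx.count α (elements μ)
          ≡⟨ count-lift α (elements μ) a (length-elements≡length μ-mux a∈) ⟩
        countᵇ (λ β → α Idx.≟ᵇ retract β) (lift (elements μ) a)
          ≡⟨ count-≡⇒countᵇ-≡ (lift (elements μ) a) (lift (elements ν) b) same-counts (λ β → α Idx.≟ᵇ retract β) ⟩
        countᵇ (λ β → α Idx.≟ᵇ retract β) (lift (elements ν) b)
          ≡⟨ count-lift α (elements ν) b (length-elements≡length ν-mux b∈) ⟨
        Idx.count α (elements ν) ∎
    a≡b : a ≡ b
    a≡b = lift-injective (elements μ) a b (length-elements≡length μ-mux a∈)
            (trans (cong (length ∘ elements) μ≡ν) (length-elements≡length ν-mux b∈))
            (IsMultiplexList.count≤ (elements-isMultiplexList μ-mux))
            (λ β → trans (same-counts β) (cong (λ ρ → Idx.count β (lift (elements ρ) b)) (sym μ≡ν)))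

  liftedPlexes : List (List ℕ)
  liftedPlexes = cartesianProductWith lifted (multiplexes (suc d) (suc n) 1 k) (balancedWords (suc n) k)

  Unique-liftedPlexes : Unique liftedPlexes
  Unique-liftedPlexes = Unique-cartesianProductWith⁺ lifted
    (λ μ∈ ν∈ a∈ b∈ → lifted-injective (∈-multiplexes⁻ μ∈) (∈-multiplexes⁻ ν∈) a∈ b∈)
    (Unique-multiplexes {suc d} {suc n} {1} {k}) (Unique-balancedWords {suc n} {k})

  ∈-liftedPlexes⁻ : ∀ {τ} → τ ∈ liftedPlexes → IsMultiplex (suc (suc (suc d))) (suc n) 1 k τ
  ∈-liftedPlexes⁻ τ∈ with ∈-cartesianProductWith⁻ lifted (multiplexes (suc d) (suc n) 1 k) (balancedWords (suc n) k) τ∈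
  ... | μ , a , μ∈ , a∈ , refl = lifted-isMultiplex (∈-multiplexes⁻ μ∈) a∈

  sum-weight-liftedPlexes :
    sum (map (weight (M _∙_ (suc (suc d)))) liftedPlexes) ≡ length (balancedWords (suc n) k) * per k (M _∙_ d)
  sum-weight-liftedPlexes = begin
    sum (map (weight (M _∙_ (suc (suc d)))) liftedPlexes)
      ≡⟨ sum-map-cartesianProductWith _ lifted (multiplexes (suc d) (suc n) 1 k) W ⟩
    sum (map (λ μ → sum (map (weight (M _∙_ (suc (suc d))) ∘ lifted μ) W)) (multiplexes (suc d) (suc n) 1 k))
      ≡⟨ sum-map-cong (multiplexes (suc d) (suc n) 1 k) (λ μ∈ → trans (sum-map-cong W (weight-lifted (∈-multiplexes⁻ μ∈)))
                                                                     (sum-map-const _ W)) ⟩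
    sum (map (λ μ → length W * weight (M _∙_ d) μ) (multiplexes (suc d) (suc n) 1 k))
      ≡⟨ sum-map-*ˡ (length W) (weight (M _∙_ d)) (multiplexes (suc d) (suc n) 1 k) ⟩
    length W * per k (M _∙_ d) ∎
    where open ≡-Reasoning

  per-step : (k * suc n) ! * per k (M _∙_ d) ≤ (k !) ^ suc n * per k (M _∙_ (suc (suc d)))
  per-step = begin
    (k * suc n) ! * per k (M _∙_ d)                     ≡⟨ cong (_* per k (M _∙_ d)) (length-balancedWords {suc n} {k}) ⟨
    length W * (k !) ^ suc n * per k (M _∙_ d)          ≡⟨ *-Semigroup.xy∙z≈y∙xz (length W) _ _ ⟩
    (k !) ^ suc n * (length W * per k (M _∙_ d))        ≡⟨ cong ((k !) ^ suc n *_) sum-weight-liftedPlexes ⟨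
    (k !) ^ suc n * sum (map (weight (M _∙_ (suc (suc d)))) liftedPlexes)
      ≤⟨ *-monoʳ-≤ ((k !) ^ suc n) (sum-weight≤PerB (M _∙_ (suc (suc d))) Unique-liftedPlexes ∈-liftedPlexes⁻) ⟩
    (k !) ^ suc n * per k (M _∙_ (suc (suc d))) ∎
    where open ≤-Reasoning

  Per>0-step : Per k (M _∙_ d) > 0 → Per k (M _∙_ (suc (suc d))) > 0
  Per>0-step Per>0 with PerB>0⇒ (M _∙_ d) Per>0 | balancedWords-nonEmpty {suc n} {k}
  ... | L , L-mux , product>0 | a , a∈ = ⇒PerB>0 (M _∙_ (suc (suc d))) (lift-isMultiplexList L-mux a∈)
    (subst (_> 0) (sym (product-map-M-lift L a |L|≡|a|)) product>0)
    where
    |L|≡|a| : length L ≡ length a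
    |L|≡|a| = trans (IsMultiplexList.length≡ L-mux) (sym (proj₁ (∈-balancedWords⁻ {k = k} a∈)))

iterate-≤ : (a b : ℕ) (p : ℕ → ℕ) → (∀ m → a * p m ≤ b * p (suc m)) → ∀ m → a ^ m * p 0 ≤ b ^ m * p m
iterate-≤ a b p step zero = ≤-refl
iterate-≤ a b p step (suc m) = begin
  a * a ^ m * p 0         ≡⟨ *-assoc a (a ^ m) (p 0) ⟩
  a * (a ^ m * p 0)       ≤⟨ *-monoʳ-≤ a (iterate-≤ a b p step m) ⟩
  a * (b ^ m * p m)       ≡⟨ *-Semigroup.x∙yz≈y∙xz a (b ^ m) (p m) ⟩
  b ^ m * (a * p m)       ≤⟨ *-monoʳ-≤ (b ^ m) (step m) ⟩
  b ^ m * (b * p (suc m)) ≡⟨ *-Semigroup.x∙yz≈xy∙z (b ^ m) b (p (suc m)) ⟩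
  b ^ m * b * p (suc m)   ≡⟨ cong (_* p (suc m)) (*-comm (b ^ m) b) ⟩
  b * b ^ m * p (suc m)   ∎
  where open ≤-Reasoning

module _ {n : ℕ} (_∙_ : Fin (suc n) → Fin (suc n) → Fin (suc n)) (q : IsQuasigroup _∙_) (k d : ℕ) where

  private
    d+2[1+m] : ∀ m → d + 2 * suc m ≡ suc (suc (d + 2 * m))
    d+2[1+m] m = trans (cong (d +_) (*-suc 2 m)) (trans (+-suc d (suc (2 * m))) (cong suc (+-suc d (2 * m))))

  Per>0-iterate : Per k (M _∙_ d) > 0 → ∀ m → Per k (M _∙_ (d + 2 * m)) > 0
  Per>0-iterate Per>0 zero = subst (λ d′ → Per k (M _∙_ d′) > 0) (sym (+-identityʳ d)) Per>0
  Per>0-iterate Per>0 (suc m) = subst (λ d′ → Per k (M _∙_ d′) > 0) (sym (d+2[1+m] m))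
    (Lifting.Per>0-step _∙_ q {d + 2 * m} {k} (Per>0-iterate Per>0 m))

  per-iterate : ∀ m → ((k * suc n) !) ^ m * per k (M _∙_ d) ≤ ((k !) ^ suc n) ^ m * per k (M _∙_ (d + 2 * m))
  per-iterate m =
    subst (λ d′ → ((k * suc n) !) ^ m * per k (M _∙_ d′) ≤ ((k !) ^ suc n) ^ m * per k (M _∙_ (d + 2 * m)))
          (+-identityʳ d)
          (iterate-≤ _ _ (λ m → per k (M _∙_ (d + 2 * m))) step m)
    where
    step : ∀ m → (k * suc n) ! * per k (M _∙_ (d + 2 * m)) ≤ (k !) ^ suc n * per k (M _∙_ (d + 2 * suc m))
    step m = subst (λ d′ → (k * suc n) ! * per k (M _∙_ (d + 2 * m)) ≤ (k !) ^ suc n * per k (M _∙_ d′))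
                   (sym (d+2[1+m] m)) (Lifting.per-step _∙_ q {d + 2 * m} {k})

lemma1 :
    -- (1)
    ((D n : ℕ) (A : Array D n) → Is01 A → (k : ℕ) → k ≥ 1 → Per k A > 0 →
       (m : ℕ) → m ≥ 1 → Per (k * m) A > 0)
    ×
    -- (2)  (the quasigroup has order suc n)
    ((n : ℕ) (op : Fin (suc n) → Fin (suc n) → Fin (suc n)) → IsQuasigroup op →
     (k d : ℕ) → d ≥ 1 → Per k (M op d) > 0 →
       ((m : ℕ) → Per k (M op (d + 2 * m)) > 0)
       ×
       ((m : ℕ) → ((k * suc n) !) ^ m * per k (M op d)
                    ≤ ((k !) ^ suc n) ^ m * per k (M op (d + 2 * m))))
lemma1 =
  (λ D n A _ k _ Per>0 m _ → Per>0⇒Per-multiple>0 A k m Per>0) ,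
  (λ n op q k d _ Per>0 → Per>0-iterate op q k d Per>0 , per-iterate op q k d)
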